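{- Let $k=\mathbb{F}_p$, let $d\ge1$, let $h\leq 2p-3$, let $A\in\mathrm{M}^h_d(k[[u]])$ and let $X\in\mathrm{M}_d(k[[u]])$ with $X\equiv I_d \bmod u^2$. Then there exists $Y\in\mathrm{GL}_d(k[[u]])$ such that $Y*_\varphi A = XA$.
   Context: $\varphi$ on $k[[u]]$ is the Frobenius $f(u)\mapsto f(u^p)$ (identity on $k$), applied entrywise to matrices; $Y*_\varphi A := YA\varphi(Y^{ -1})$. $\mathrm{M}^h_d(k[[u]]) = \{A\in \mathrm{M}_d(k[[u]]) : \exists B,\ AB = BA = u^h I_d\}$. -}

module Defs where

open import Data.Nat using (ℕ; zero; suc; _+_; _*_; _∸_; _<_)
open import Data.Nat.Divisibility using (_∣?_; divides)
open import Data.Fin using (Fin)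
open import Data.List using (List; upTo; map)
open import Data.Nat.ListAction using (sum)
open import Data.Product using (∃₂)
open import Relation.Nullary using (yes; no)
open import Relation.Binary.PropositionalEquality using (_≡_)

-- Congruence modulo p on ℕ: elements of F_p = ℕ/pℕ are represented by naturals.
_≡[mod_]_ : ℕ → ℕ → ℕ → Set
a ≡[mod p ] b = ∃₂ λ x y → a + x * p ≡ b + y * p

-- Formal power series in u with coefficients in ℕ (read modulo p): n ↦ coefficient of u^n.
PS : Set
PS = ℕ → ℕ

_·ₛ_ : PS → PS → PS
(f ·ₛ g) n = sum (map (λ i → f i * g (n ∸ i)) (upTo (suc n)))

_+ₛ_ : PS → PS → PS
(f +ₛ g) n = f n + g n

0ₛ : PS
0ₛ _ = 0

-- Frobenius φ(f)(u) = f(u^p): coefficient of u^n is f_(n/p) if p ∣ n, else 0.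
φₛ : ℕ → PS → PS
φₛ p f n with p ∣? n
... | yes (divides q _) = f q
... | no _ = 0

Mat : ℕ → Set
Mat d = Fin d → Fin d → PS

sumFin : (d : ℕ) → (Fin d → PS) → PS
sumFin zero g = 0ₛ
sumFin (suc d) g = g Fin.zero +ₛ sumFin d (λ i → g (Fin.suc i))

_·ₘ_ : {d : ℕ} → Mat d → Mat d → Mat d
_·ₘ_ {d} A B i j = sumFin d (λ l → A i l ·ₛ B l j)

φₘ : {d : ℕ} → ℕ → Mat d → Mat d
φₘ p A i j = φₛ p (A i j)

uPowI : (d h : ℕ) → Mat d
uPowI d h i j n with i Data.Fin.≟ j | n Data.Nat.≟ h
... | yes _ | yes _ = 1
... | _ | _ = 0
  where import Data.Fin ; import Data.Nat

Iₘ : (d : ℕ) → Mat d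
Iₘ d = uPowI d 0

MatEq : (p : ℕ) {d : ℕ} → Mat d → Mat d → Set
MatEq p {d} A B = ∀ (i j : Fin d) (n : ℕ) → A i j n ≡[mod p ] B i j n

MatEqModU : (p : ℕ) {d : ℕ} → ℕ → Mat d → Mat d → Set
MatEqModU p {d} m A B = ∀ (i j : Fin d) (n : ℕ) → n < m → A i j n ≡[mod p ] B i j n

InMh : (p d h : ℕ) → Mat d → Set
InMh p d h A = Data.Product.∃ λ (B : Mat d) → Data.Product._×_ (MatEq p (A ·ₘ B) (uPowI d h)) (MatEq p (B ·ₘ A) (uPowI d h))
  where import Data.Product

-- Write Y = I + E and X = I + T, where T ≡ 0 mod u².  Since B A = u^h and u^h is central, it suffices to
-- find E with u^h E = u^h T + X A φ(E) B: multiplying by A on the right and cancelling u^h then gives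
-- E A = T A + X A φ(E), i.e. Y A = X A φ(Y).  Such an E is the u-adic fixed point of
-- M ↦ T + u^(-h) X A φ(M) B (with the coefficients of u⁰ and u¹ dropped): as φ(M) ≡ 0 mod u^(2p) once
-- M ≡ 0 mod u², and h + 2 < 2p, the division by u^h is exact and the map is a contraction.  Finally
-- Y ≡ I mod u is invertible (R = I − E R is again a contraction), and since φ is a ring endomorphism,
-- Y A = X A φ(Y) turns into Y A φ(Y⁻¹) = X A.
module Submission where

open import Algebra.Bundles using (Semiring)
open import Algebra.Structures using (IsSemiring)
open import Data.Fin using (Fin) renaming (zero to fzero; suc to fsuc)
import Data.Fin as Fin
open import Data.List using (upTo; applyUpTo; map)
open import Data.List.Properties using (map-applyUpTo)
open import Data.Nat using (ℕ; zero; suc; _+_; _*_; _∸_; _≤_; _<_; z≤n; s≤s; s≤s⁻¹; _<?_)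
import Data.Nat as ℕ
open import Data.Nat.Divisibility using (_∣?_; divides; _∣0; ∣-refl; ∣m+n∣m⇒∣n; ∣m∣n⇒∣m+n)
open import Data.Nat.Induction using (<-rec)
import Data.Nat.ListAction as List
open import Data.Nat.Primality using (Prime)
open import Data.Nat.Properties
open import Data.Nat.Tactic.RingSolver using (solve-∀)
open import Data.Product using (_,_; _×_; ∃; ∃₂)
open import Function using (_∘_)
open import Level using (0ℓ)
open import Relation.Binary.PropositionalEquality
open import Relation.Nullary using (yes; no; contradiction)
open import Defs

_≡[<_]_ : PS → ℕ → PS → Set
f ≡[< m ] g = ∀ n → n < m → f n ≡ g n

shiftL : ℕ → PS → PS
shiftL k f n = f (k + n)

shiftR : ℕ → PS → PS
shiftR zero f = f
shiftR (suc k) f zero = 0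
shiftR (suc k) f (suc n) = shiftR k f n

monomial : ℕ → PS
monomial k = shiftR k (λ { zero → 1 ; (suc _) → 0 })

dropBelow : ℕ → PS → PS
dropBelow k f = shiftR k (shiftL k f)

_•ₛ_ : ℕ → PS → PS
(c •ₛ f) n = c * f n

·ₛ-suc : ∀ f g n → (f ·ₛ g) (suc n) ≡ f 0 * g (suc n) + (shiftL 1 f ·ₛ g) n
·ₛ-suc f g n = cong (λ xs → f 0 * g (suc n) + List.sum xs) (begin
  map F (applyUpTo suc (suc n))  ≡⟨ map-applyUpTo suc F (suc n) ⟩
  applyUpTo (λ i → F (suc i)) (suc n) ≡⟨ map-applyUpTo (λ i → i) (λ i → F (suc i)) (suc n) ⟨
  map (λ i → F (suc i)) (upTo (suc n)) ∎)
  where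
  open ≡-Reasoning
  F : ℕ → ℕ
  F i = f i * g (suc n ∸ i)

·ₛ-agree : ∀ {f f′ g g′} n → f ≡[< suc n ] f′ → g ≡[< suc n ] g′ → (f ·ₛ g) n ≡ (f′ ·ₛ g′) n
·ₛ-agree zero ef eg = cong (_+ 0) (cong₂ _*_ (ef 0 (s≤s z≤n)) (eg 0 (s≤s z≤n)))
·ₛ-agree {f} {f′} {g} {g′} (suc n) ef eg = begin
  (f ·ₛ g) (suc n)                          ≡⟨ ·ₛ-suc f g n ⟩
  f 0 * g (suc n) + (shiftL 1 f ·ₛ g) n     ≡⟨ cong₂ _+_ (cong₂ _*_ (ef 0 (s≤s z≤n)) (eg (suc n) ≤-refl))
                                                 (·ₛ-agree {shiftL 1 f} {shiftL 1 f′} {g} {g′} n 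
                                                   (λ i i<1+n → ef (suc i) (s≤s i<1+n)) (λ i i<1+n → eg i (m<n⇒m<1+n i<1+n))) ⟩
  f′ 0 * g′ (suc n) + (shiftL 1 f′ ·ₛ g′) n ≡⟨ ·ₛ-suc f′ g′ n ⟨
  (f′ ·ₛ g′) (suc n)                        ∎
  where open ≡-Reasoning

·ₛ-cong : ∀ {f f′ g g′} → f ≗ f′ → g ≗ g′ → (f ·ₛ g) ≗ (f′ ·ₛ g′)
·ₛ-cong ef eg n = ·ₛ-agree n (λ i _ → ef i) (λ i _ → eg i)

·ₛ-agreeʳ : ∀ {f g g′} n → f 0 ≡ 0 → g ≡[< n ] g′ → (f ·ₛ g) n ≡ (f ·ₛ g′) n
·ₛ-agreeʳ {f} {g} {g′} zero f0 _ = cong (_+ 0) (trans (cong (_* g 0) f0) (cong (_* g′ 0) (sym f0)))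
·ₛ-agreeʳ {f} {g} {g′} (suc n) f0 eg = begin
  (f ·ₛ g) (suc n)                       ≡⟨ ·ₛ-suc f g n ⟩
  f 0 * g (suc n) + (shiftL 1 f ·ₛ g) n  ≡⟨ cong₂ _+_ (trans (cong (_* g (suc n)) f0) (cong (_* g′ (suc n)) (sym f0)))
                                              (·ₛ-agree {shiftL 1 f} {shiftL 1 f} {g} {g′} n (λ _ _ → refl) eg) ⟩
  f 0 * g′ (suc n) + (shiftL 1 f ·ₛ g′) n ≡⟨ ·ₛ-suc f g′ n ⟨
  (f ·ₛ g′) (suc n)                      ∎
  where open ≡-Reasoning

·ₛ-agreeˡ : ∀ {f f′ g} n → g 0 ≡ 0 → f ≡[< n ] f′ → (f ·ₛ g) n ≡ (f′ ·ₛ g) n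
·ₛ-agreeˡ {f} {f′} {g} zero g0 _ = begin
  f 0 * g 0 + 0  ≡⟨ cong (λ x → f 0 * x + 0) g0 ⟩
  f 0 * 0 + 0    ≡⟨ cong (_+ 0) (trans (*-zeroʳ (f 0)) (sym (*-zeroʳ (f′ 0)))) ⟩
  f′ 0 * 0 + 0   ≡⟨ cong (λ x → f′ 0 * x + 0) g0 ⟨
  f′ 0 * g 0 + 0 ∎
  where open ≡-Reasoning
·ₛ-agreeˡ {f} {f′} {g} (suc n) g0 ef = begin
  (f ·ₛ g) (suc n)                         ≡⟨ ·ₛ-suc f g n ⟩
  f 0 * g (suc n) + (shiftL 1 f ·ₛ g) n    ≡⟨ cong₂ _+_ (cong (_* g (suc n)) (ef 0 (s≤s z≤n)))
                                                (·ₛ-agreeˡ {shiftL 1 f} {shiftL 1 f′} {g} n g0 (λ i i<n → ef (suc i) (s≤s i<n))) ⟩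
  f′ 0 * g (suc n) + (shiftL 1 f′ ·ₛ g) n  ≡⟨ ·ₛ-suc f′ g n ⟨
  (f′ ·ₛ g) (suc n)                        ∎
  where open ≡-Reasoning

·ₛ-zeroˡ : ∀ g → (0ₛ ·ₛ g) ≗ 0ₛ
·ₛ-zeroˡ g zero = refl
·ₛ-zeroˡ g (suc n) = trans (·ₛ-suc 0ₛ g n) (·ₛ-zeroˡ g n)

·ₛ-zeroʳ : ∀ f → (f ·ₛ 0ₛ) ≗ 0ₛ
·ₛ-zeroʳ f zero = cong (_+ 0) (*-zeroʳ (f 0))
·ₛ-zeroʳ f (suc n) = trans (·ₛ-suc f 0ₛ n) (cong₂ _+_ (*-zeroʳ (f 0)) (·ₛ-zeroʳ (shiftL 1 f) n))

·ₛ-•ₛˡ : ∀ c f g → ((c •ₛ f) ·ₛ g) ≗ (c •ₛ (f ·ₛ g))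
·ₛ-•ₛˡ c f g zero = trans (+-identityʳ _) (trans (*-assoc c (f 0) (g 0)) (cong (c *_) (sym (+-identityʳ _))))
·ₛ-•ₛˡ c f g (suc n) = begin
  ((c •ₛ f) ·ₛ g) (suc n)                              ≡⟨ ·ₛ-suc (c •ₛ f) g n ⟩
  c * f 0 * g (suc n) + ((c •ₛ shiftL 1 f) ·ₛ g) n     ≡⟨ cong₂ _+_ (*-assoc c (f 0) (g (suc n))) (·ₛ-•ₛˡ c (shiftL 1 f) g n) ⟩
  c * (f 0 * g (suc n)) + c * (shiftL 1 f ·ₛ g) n      ≡⟨ *-distribˡ-+ c _ _ ⟨
  c * (f 0 * g (suc n) + (shiftL 1 f ·ₛ g) n)          ≡⟨ cong (c *_) (·ₛ-suc f g n) ⟨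
  c * (f ·ₛ g) (suc n)                                 ∎
  where open ≡-Reasoning

·ₛ-distribˡ : ∀ f g h → (f ·ₛ (g +ₛ h)) ≗ ((f ·ₛ g) +ₛ (f ·ₛ h))
·ₛ-distribˡ f g h zero = lemma (f 0) (g 0) (h 0)
  where
  lemma : ∀ a b c → a * (b + c) + 0 ≡ (a * b + 0) + (a * c + 0)
  lemma = solve-∀
·ₛ-distribˡ f g h (suc n) = begin
  (f ·ₛ (g +ₛ h)) (suc n)
    ≡⟨ ·ₛ-suc f (g +ₛ h) n ⟩
  f 0 * (g (suc n) + h (suc n)) + (shiftL 1 f ·ₛ (g +ₛ h)) n
    ≡⟨ cong (f 0 * (g (suc n) + h (suc n)) +_) (·ₛ-distribˡ (shiftL 1 f) g h n) ⟩
  f 0 * (g (suc n) + h (suc n)) + ((shiftL 1 f ·ₛ g) n + (shiftL 1 f ·ₛ h) n)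
    ≡⟨ lemma (f 0) (g (suc n)) (h (suc n)) _ _ ⟩
  (f 0 * g (suc n) + (shiftL 1 f ·ₛ g) n) + (f 0 * h (suc n) + (shiftL 1 f ·ₛ h) n)
    ≡⟨ cong₂ _+_ (·ₛ-suc f g n) (·ₛ-suc f h n) ⟨
  (f ·ₛ g) (suc n) + (f ·ₛ h) (suc n) ∎
  where
  open ≡-Reasoning
  lemma : ∀ a b c d e → a * (b + c) + (d + e) ≡ (a * b + d) + (a * c + e)
  lemma = solve-∀

·ₛ-distribʳ : ∀ h f g → ((f +ₛ g) ·ₛ h) ≗ ((f ·ₛ h) +ₛ (g ·ₛ h))
·ₛ-distribʳ h f g zero = lemma (f 0) (g 0) (h 0)
  where
  lemma : ∀ a b c → (a + b) * c + 0 ≡ (a * c + 0) + (b * c + 0)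
  lemma = solve-∀
·ₛ-distribʳ h f g (suc n) = begin
  ((f +ₛ g) ·ₛ h) (suc n)
    ≡⟨ ·ₛ-suc (f +ₛ g) h n ⟩
  (f 0 + g 0) * h (suc n) + ((shiftL 1 f +ₛ shiftL 1 g) ·ₛ h) n
    ≡⟨ cong ((f 0 + g 0) * h (suc n) +_) (·ₛ-distribʳ h (shiftL 1 f) (shiftL 1 g) n) ⟩
  (f 0 + g 0) * h (suc n) + ((shiftL 1 f ·ₛ h) n + (shiftL 1 g ·ₛ h) n)
    ≡⟨ lemma (f 0) (g 0) (h (suc n)) _ _ ⟩
  (f 0 * h (suc n) + (shiftL 1 f ·ₛ h) n) + (g 0 * h (suc n) + (shiftL 1 g ·ₛ h) n)
    ≡⟨ cong₂ _+_ (·ₛ-suc f h n) (·ₛ-suc g h n) ⟨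
  (f ·ₛ h) (suc n) + (g ·ₛ h) (suc n) ∎
  where
  open ≡-Reasoning
  lemma : ∀ a b c d e → (a + b) * c + (d + e) ≡ (a * c + d) + (b * c + e)
  lemma = solve-∀

·ₛ-assoc : ∀ f g h → ((f ·ₛ g) ·ₛ h) ≗ (f ·ₛ (g ·ₛ h))
·ₛ-assoc f g h zero = lemma (f 0) (g 0) (h 0)
  where
  lemma : ∀ a b c → (a * b + 0) * c + 0 ≡ a * (b * c + 0) + 0
  lemma = solve-∀
·ₛ-assoc f g h (suc n) = begin
  ((f ·ₛ g) ·ₛ h) (suc n)
    ≡⟨ ·ₛ-suc (f ·ₛ g) h n ⟩
  (f ·ₛ g) 0 * h (suc n) + (shiftL 1 (f ·ₛ g) ·ₛ h) n
    ≡⟨ cong ((f ·ₛ g) 0 * h (suc n) +_) (·ₛ-cong {shiftL 1 (f ·ₛ g)} {_} {h} (·ₛ-suc f g) (λ _ → refl) n) ⟩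
  (f ·ₛ g) 0 * h (suc n) + (((f 0 •ₛ shiftL 1 g) +ₛ (shiftL 1 f ·ₛ g)) ·ₛ h) n
    ≡⟨ cong ((f ·ₛ g) 0 * h (suc n) +_) (·ₛ-distribʳ h (f 0 •ₛ shiftL 1 g) (shiftL 1 f ·ₛ g) n) ⟩
  (f ·ₛ g) 0 * h (suc n) + (((f 0 •ₛ shiftL 1 g) ·ₛ h) n + ((shiftL 1 f ·ₛ g) ·ₛ h) n)
    ≡⟨ cong ((f ·ₛ g) 0 * h (suc n) +_) (cong₂ _+_ (·ₛ-•ₛˡ (f 0) (shiftL 1 g) h n) (·ₛ-assoc (shiftL 1 f) g h n)) ⟩
  (f 0 * g 0 + 0) * h (suc n) + (f 0 * (shiftL 1 g ·ₛ h) n + (shiftL 1 f ·ₛ (g ·ₛ h)) n)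
    ≡⟨ lemma (f 0) (g 0) (h (suc n)) _ _ ⟩
  f 0 * (g 0 * h (suc n) + (shiftL 1 g ·ₛ h) n) + (shiftL 1 f ·ₛ (g ·ₛ h)) n
    ≡⟨ cong (λ x → f 0 * x + (shiftL 1 f ·ₛ (g ·ₛ h)) n) (·ₛ-suc g h n) ⟨
  f 0 * (g ·ₛ h) (suc n) + (shiftL 1 f ·ₛ (g ·ₛ h)) n
    ≡⟨ ·ₛ-suc f (g ·ₛ h) n ⟨
  (f ·ₛ (g ·ₛ h)) (suc n) ∎
  where
  open ≡-Reasoning
  lemma : ∀ a b c d e → (a * b + 0) * c + (a * d + e) ≡ a * (b * c + d) + e
  lemma = solve-∀

·ₛ-monomialˡ : ∀ k g → (monomial k ·ₛ g) ≗ shiftR k g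
·ₛ-monomialˡ zero g zero = trans (+-identityʳ (1 * g 0)) (*-identityˡ (g 0))
·ₛ-monomialˡ zero g (suc n) = trans (·ₛ-suc (monomial 0) g n)
  (trans (cong₂ _+_ (*-identityˡ (g (suc n))) (·ₛ-zeroˡ g n)) (+-identityʳ (g (suc n))))
·ₛ-monomialˡ (suc k) g zero = refl
·ₛ-monomialˡ (suc k) g (suc n) = trans (·ₛ-suc (monomial (suc k)) g n) (·ₛ-monomialˡ k g n)

shiftR-unfold : ∀ k f n → shiftR k f n ≡ f 0 * monomial k n + shiftR (suc k) (shiftL 1 f) n
shiftR-unfold zero f zero = sym (trans (+-identityʳ _) (*-identityʳ (f 0)))
shiftR-unfold zero f (suc n) = cong (_+ f (suc n)) (sym (*-zeroʳ (f 0)))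
shiftR-unfold (suc k) f zero = sym (trans (+-identityʳ _) (*-zeroʳ (f 0)))
shiftR-unfold (suc k) f (suc n) = shiftR-unfold k f n

·ₛ-monomialʳ : ∀ k f → (f ·ₛ monomial k) ≗ shiftR k f
·ₛ-monomialʳ zero f zero = trans (+-identityʳ _) (*-identityʳ (f 0))
·ₛ-monomialʳ (suc k) f zero = trans (+-identityʳ _) (*-zeroʳ (f 0))
·ₛ-monomialʳ k f (suc n) = begin
  (f ·ₛ monomial k) (suc n)                                  ≡⟨ ·ₛ-suc f (monomial k) n ⟩
  f 0 * monomial k (suc n) + (shiftL 1 f ·ₛ monomial k) n    ≡⟨ cong (f 0 * monomial k (suc n) +_) (·ₛ-monomialʳ k (shiftL 1 f) n) ⟩
  f 0 * monomial k (suc n) + shiftR k (shiftL 1 f) n         ≡⟨ shiftR-unfold k f (suc n) ⟨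
  shiftR k f (suc n)                                         ∎
  where open ≡-Reasoning

shiftR-cong : ∀ k {f g} → f ≗ g → shiftR k f ≗ shiftR k g
shiftR-cong zero e n = e n
shiftR-cong (suc k) e zero = refl
shiftR-cong (suc k) e (suc n) = shiftR-cong k e n

shiftR-+ : ∀ k f g → shiftR k (f +ₛ g) ≗ (shiftR k f +ₛ shiftR k g)
shiftR-+ zero f g n = refl
shiftR-+ (suc k) f g zero = refl
shiftR-+ (suc k) f g (suc n) = shiftR-+ k f g n

shiftR-shiftL : ∀ k f → f ≡[< k ] 0ₛ → shiftR k (shiftL k f) ≗ f
shiftR-shiftL zero f _ n = refl
shiftR-shiftL (suc k) f f≡0 zero = sym (f≡0 0 (s≤s z≤n))
shiftR-shiftL (suc k) f f≡0 (suc n) = shiftR-shiftL k (shiftL 1 f) (λ i i<k → f≡0 (suc i) (s≤s i<k)) n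

shiftR-k+n : ∀ k f n → shiftR k f (k + n) ≡ f n
shiftR-k+n zero f n = refl
shiftR-k+n (suc k) f n = shiftR-k+n k f n

·ₛ-shiftˡ : ∀ k f g n → f ≡[< k ] 0ₛ → (f ·ₛ g) (k + n) ≡ (shiftL k f ·ₛ g) n
·ₛ-shiftˡ zero f g n _ = ·ₛ-cong {f} {shiftL 0 f} {g} (λ _ → refl) (λ _ → refl) n
·ₛ-shiftˡ (suc k) f g n f≡0 = begin
  (f ·ₛ g) (suc k + n)                         ≡⟨ ·ₛ-suc f g (k + n) ⟩
  f 0 * g (suc k + n) + (shiftL 1 f ·ₛ g) (k + n) ≡⟨ cong (_+ (shiftL 1 f ·ₛ g) (k + n)) (cong (_* g (suc k + n)) (f≡0 0 (s≤s z≤n))) ⟩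
  (shiftL 1 f ·ₛ g) (k + n)                    ≡⟨ ·ₛ-shiftˡ k (shiftL 1 f) g n (λ i i<k → f≡0 (suc i) (s≤s i<k)) ⟩
  (shiftL (suc k) f ·ₛ g) n                    ∎
  where open ≡-Reasoning

·ₛ-vanishingˡ : ∀ f g n → f ≡[< suc n ] 0ₛ → (f ·ₛ g) n ≡ 0
·ₛ-vanishingˡ f g n f≡0 = trans (·ₛ-agree {f} {0ₛ} {g} {g} n f≡0 (λ _ _ → refl)) (·ₛ-zeroˡ g n)

dropBelow-+ : ∀ k f g → dropBelow k (f +ₛ g) ≗ (dropBelow k f +ₛ dropBelow k g)
dropBelow-+ k f g = shiftR-+ k (shiftL k f) (shiftL k g)

monomial-same : ∀ k → monomial k k ≡ 1
monomial-same zero = refl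
monomial-same (suc k) = monomial-same k

monomial-other : ∀ k n → n ≢ k → monomial k n ≡ 0
monomial-other zero zero n≢k = contradiction refl n≢k
monomial-other zero (suc n) _ = refl
monomial-other (suc k) zero _ = refl
monomial-other (suc k) (suc n) n≢k = monomial-other k n (n≢k ∘ cong suc)

module Frobenius (p′ : ℕ) where

  p : ℕ
  p = suc p′

  φ : PS → PS
  φ = φₛ p

  φ-cong : ∀ {f g} → f ≗ g → φ f ≗ φ g
  φ-cong {f} {g} e n with p ∣? n
  ... | yes (divides q _) = e q
  ... | no _ = refl

  φ-+ : ∀ f g → φ (f +ₛ g) ≗ (φ f +ₛ φ g)
  φ-+ f g n with p ∣? n
  ... | yes _ = refl
  ... | no _ = refl

  φ-•ₛ : ∀ c f → φ (c •ₛ f) ≗ (c •ₛ φ f)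
  φ-•ₛ c f n with p ∣? n
  ... | yes _ = refl
  ... | no _ = sym (*-zeroʳ c)

  φ-0ₛ : φ 0ₛ ≗ 0ₛ
  φ-0ₛ n with p ∣? n
  ... | yes _ = refl
  ... | no _ = refl

  φ-vanishes : ∀ f n → 0 < n → n < p → φ f n ≡ 0
  φ-vanishes f n 0<n n<p with p ∣? n
  ... | yes (divides zero n≡0) = contradiction n≡0 (≢-sym (<⇒≢ 0<n))
  ... | yes (divides (suc q) n≡pq) = contradiction (subst (_< p) n≡pq n<p) (≤⇒≯ (m≤m+n p (q * p)))
  ... | no _ = refl

  φ-shift : ∀ f m → φ f (p + m) ≡ φ (shiftL 1 f) m
  φ-shift f m with p ∣? (p + m) | p ∣? m
  ... | yes (divides q e) | yes (divides q′ e′) = cong f (*-cancelʳ-≡ q (suc q′) p (trans (sym e) (cong (p +_) e′)))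
  ... | yes p∣p+m | no p∤m = contradiction (∣m+n∣m⇒∣n p∣p+m ∣-refl) p∤m
  ... | no p∤p+m | yes p∣m = contradiction (∣m∣n⇒∣m+n ∣-refl p∣m) p∤p+m
  ... | no _ | no _ = refl

  φ-agree : ∀ m {f g} → f ≡[< m ] g → φ f ≡[< p * m ] φ g
  φ-agree m e n n<pm with p ∣? n
  ... | yes (divides q n≡qp) = e q (*-cancelʳ-< p q m (subst₂ _<_ n≡qp (*-comm p m) n<pm))
  ... | no _ = refl

  φ-monomial₀ : φ (monomial 0) ≗ monomial 0
  φ-monomial₀ n with p ∣? n
  φ-monomial₀ n | yes (divides zero n≡0) = sym (cong (monomial 0) n≡0)
  φ-monomial₀ n | yes (divides (suc q) n≡pq) = sym (cong (monomial 0) n≡pq)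
  φ-monomial₀ zero | no p∤0 = contradiction (p ∣0) p∤0
  φ-monomial₀ (suc n) | no _ = refl

  φ-·ₛ-below : ∀ f g n → n < p → (φ f ·ₛ φ g) n ≡ φ (f ·ₛ g) n
  φ-·ₛ-below f g zero _ = refl
  φ-·ₛ-below f g (suc n) n<p = begin
    (φ f ·ₛ φ g) (suc n)                       ≡⟨ ·ₛ-suc (φ f) (φ g) n ⟩
    f 0 * φ g (suc n) + (shiftL 1 (φ f) ·ₛ φ g) n
      ≡⟨ cong₂ _+_ (cong (f 0 *_) (φ-vanishes g (suc n) (s≤s z≤n) n<p))
                   (·ₛ-vanishingˡ (shiftL 1 (φ f)) (φ g) n (λ i i<1+n → φ-vanishes f (suc i) (s≤s z≤n) (≤-<-trans i<1+n n<p))) ⟩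
    f 0 * 0 + 0                                ≡⟨ cong (_+ 0) (*-zeroʳ (f 0)) ⟩
    0                                          ≡⟨ φ-vanishes (f ·ₛ g) (suc n) (s≤s z≤n) n<p ⟨
    φ (f ·ₛ g) (suc n)                         ∎
    where open ≡-Reasoning

  φ-·ₛ-step : ∀ f g m → (φ (shiftL 1 f) ·ₛ φ g) m ≡ φ (shiftL 1 f ·ₛ g) m →
    (φ f ·ₛ φ g) (p + m) ≡ φ (f ·ₛ g) (p + m)
  φ-·ₛ-step f g m ih = begin
    (φ f ·ₛ φ g) (p + m)                                     ≡⟨ ·ₛ-suc (φ f) (φ g) (p′ + m) ⟩
    f 0 * φ g (p + m) + (shiftL 1 (φ f) ·ₛ φ g) (p′ + m)
      ≡⟨ cong₂ _+_ (cong (f 0 *_) (φ-shift g m))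
                   (·ₛ-shiftˡ p′ (shiftL 1 (φ f)) (φ g) m (λ i i<p′ → φ-vanishes f (suc i) (s≤s z≤n) (s≤s i<p′))) ⟩
    f 0 * φ (shiftL 1 g) m + (shiftL p (φ f) ·ₛ φ g) m
      ≡⟨ cong (f 0 * φ (shiftL 1 g) m +_) (trans (·ₛ-cong {shiftL p (φ f)} {_} {φ g} (φ-shift f) (λ _ → refl) m) ih) ⟩
    f 0 * φ (shiftL 1 g) m + φ (shiftL 1 f ·ₛ g) m           ≡⟨ cong₂ _+_ (φ-•ₛ (f 0) (shiftL 1 g) m) refl ⟨
    φ (f 0 •ₛ shiftL 1 g) m + φ (shiftL 1 f ·ₛ g) m          ≡⟨ φ-+ (f 0 •ₛ shiftL 1 g) (shiftL 1 f ·ₛ g) m ⟨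
    φ ((f 0 •ₛ shiftL 1 g) +ₛ (shiftL 1 f ·ₛ g)) m           ≡⟨ φ-cong (·ₛ-suc f g) m ⟨
    φ (shiftL 1 (f ·ₛ g)) m                                  ≡⟨ φ-shift (f ·ₛ g) m ⟨
    φ (f ·ₛ g) (p + m)                                       ∎
    where open ≡-Reasoning

  φ-·ₛ : ∀ f g → (φ f ·ₛ φ g) ≗ φ (f ·ₛ g)
  φ-·ₛ f g n = <-rec (λ n → ∀ f g → (φ f ·ₛ φ g) n ≡ φ (f ·ₛ g) n) step n f g
    where
    step : ∀ n → (∀ {m} → m < n → ∀ f g → (φ f ·ₛ φ g) m ≡ φ (f ·ₛ g) m) →
           ∀ f g → (φ f ·ₛ φ g) n ≡ φ (f ·ₛ g) n
    step n rec f g with n <? p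
    ... | yes n<p = φ-·ₛ-below f g n n<p
    ... | no n≮p = subst (λ x → (φ f ·ₛ φ g) x ≡ φ (f ·ₛ g) x) (m+[n∸m]≡n (≮⇒≥ n≮p))
      (φ-·ₛ-step f g (n ∸ p) (rec (∸-monoʳ-< {o = 0} (s≤s z≤n) (≮⇒≥ n≮p)) (shiftL 1 f) g))

module _ {p : ℕ} where

  ≡⇒≡[mod] : ∀ {a b} → a ≡ b → a ≡[mod p ] b
  ≡⇒≡[mod] refl = 0 , 0 , refl

  ≡[mod]-sym : ∀ {a b} → a ≡[mod p ] b → b ≡[mod p ] a
  ≡[mod]-sym (x , y , e) = y , x , sym e

  ≡[mod]-trans : ∀ {a b c} → a ≡[mod p ] b → b ≡[mod p ] c → a ≡[mod p ] c
  ≡[mod]-trans {a} {b} {c} (x , y , e) (x′ , y′ , e′) = x + x′ , y′ + y , (begin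
    a + (x + x′) * p   ≡⟨ lemma a x x′ p ⟩
    (a + x * p) + x′ * p ≡⟨ cong (_+ x′ * p) e ⟩
    (b + y * p) + x′ * p ≡⟨ +-comm-last b (y * p) (x′ * p) ⟩
    (b + x′ * p) + y * p ≡⟨ cong (_+ y * p) e′ ⟩
    (c + y′ * p) + y * p ≡⟨ lemma c y′ y p ⟨
    c + (y′ + y) * p   ∎)
    where
    open ≡-Reasoning
    lemma : ∀ a x x′ p → a + (x + x′) * p ≡ (a + x * p) + x′ * p
    lemma = solve-∀
    +-comm-last : ∀ a b c → a + b + c ≡ a + c + b
    +-comm-last = solve-∀

  ≡[mod]-+ : ∀ {a b c d} → a ≡[mod p ] b → c ≡[mod p ] d → (a + c) ≡[mod p ] (b + d)
  ≡[mod]-+ {a} {b} {c} {d} (x , y , e) (x′ , y′ , e′) = x + x′ , y + y′ , (begin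
    a + c + (x + x′) * p       ≡⟨ lemma a c x x′ p ⟩
    (a + x * p) + (c + x′ * p) ≡⟨ cong₂ _+_ e e′ ⟩
    (b + y * p) + (d + y′ * p) ≡⟨ lemma b d y y′ p ⟨
    b + d + (y + y′) * p       ∎)
    where
    open ≡-Reasoning
    lemma : ∀ a c x x′ p → a + c + (x + x′) * p ≡ (a + x * p) + (c + x′ * p)
    lemma = solve-∀

  ≡[mod]-* : ∀ {a b c d} → a ≡[mod p ] b → c ≡[mod p ] d → (a * c) ≡[mod p ] (b * d)
  ≡[mod]-* {a} {b} {c} {d} (x , y , e) (x′ , y′ , e′) =
    x * c + a * x′ + x * x′ * p , y * d + b * y′ + y * y′ * p , (begin
    a * c + (x * c + a * x′ + x * x′ * p) * p ≡⟨ lemma a c x x′ p ⟩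
    (a + x * p) * (c + x′ * p)               ≡⟨ cong₂ _*_ e e′ ⟩
    (b + y * p) * (d + y′ * p)               ≡⟨ lemma b d y y′ p ⟨
    b * d + (y * d + b * y′ + y * y′ * p) * p ∎)
    where
    open ≡-Reasoning
    lemma : ∀ a c x x′ p → a * c + (x * c + a * x′ + x * x′ * p) * p ≡ (a + x * p) * (c + x′ * p)
    lemma = solve-∀

≡[mod]-multiple : ∀ p′ a → (p′ * a + a) ≡[mod suc p′ ] 0
≡[mod]-multiple p′ a = 0 , a , lemma p′ a
  where
  lemma : ∀ p′ a → p′ * a + a + 0 * suc p′ ≡ 0 + a * suc p′
  lemma = solve-∀

module PowerSeriesModP (p : ℕ) where

  infix 4 _≈_
  _≈_ : PS → PS → Set
  f ≈ g = ∀ n → f n ≡[mod p ] g n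

  ≗⇒≈ : ∀ {f g} → f ≗ g → f ≈ g
  ≗⇒≈ e n = ≡⇒≡[mod] (e n)

  ·ₛ-cong-≈ : ∀ {f f′ g g′} → f ≈ f′ → g ≈ g′ → (f ·ₛ g) ≈ (f′ ·ₛ g′)
  ·ₛ-cong-≈ ef eg zero = ≡[mod]-+ (≡[mod]-* (ef 0) (eg 0)) (≡⇒≡[mod] refl)
  ·ₛ-cong-≈ {f} {f′} {g} {g′} ef eg (suc n) =
    ≡[mod]-trans (≡⇒≡[mod] (·ₛ-suc f g n))
      (≡[mod]-trans (≡[mod]-+ (≡[mod]-* (ef 0) (eg (suc n)))
                              (·ₛ-cong-≈ {shiftL 1 f} {shiftL 1 f′} {g} {g′} (λ i → ef (suc i)) eg n))
        (≡⇒≡[mod] (sym (·ₛ-suc f′ g′ n))))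

  isSemiring : IsSemiring _≈_ _+ₛ_ _·ₛ_ 0ₛ (monomial 0)
  isSemiring = record
    { isSemiringWithoutAnnihilatingZero = record
      { +-isCommutativeMonoid = record
        { isMonoid = record
          { isSemigroup = record
            { isMagma = record
              { isEquivalence = record
                { refl = λ _ → ≡⇒≡[mod] refl ; sym = λ e n → ≡[mod]-sym (e n) ; trans = λ e e′ n → ≡[mod]-trans (e n) (e′ n) }
              ; ∙-cong = λ e e′ n → ≡[mod]-+ (e n) (e′ n) }
            ; assoc = λ f g h → ≗⇒≈ (λ n → +-assoc (f n) (g n) (h n)) }
          ; identity = (λ f → ≗⇒≈ (λ _ → refl)) , (λ f → ≗⇒≈ (λ n → +-identityʳ (f n))) }
        ; comm = λ f g → ≗⇒≈ (λ n → +-comm (f n) (g n)) }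
      ; *-cong = ·ₛ-cong-≈
      ; *-assoc = λ f g h → ≗⇒≈ (·ₛ-assoc f g h)
      ; *-identity = (λ f → ≗⇒≈ (·ₛ-monomialˡ 0 f)) , (λ f → ≗⇒≈ (·ₛ-monomialʳ 0 f))
      ; distrib = (λ f g h → ≗⇒≈ (·ₛ-distribˡ f g h)) , (λ h f g → ≗⇒≈ (·ₛ-distribʳ h f g))
      }
    ; zero = (λ f → ≗⇒≈ (·ₛ-zeroˡ f)) , (λ f → ≗⇒≈ (·ₛ-zeroʳ f))
    }

  semiring : Semiring 0ℓ 0ℓ
  semiring = record { isSemiring = isSemiring }

infixl 6 _+ₘ_
_+ₘ_ : ∀ {d} → Mat d → Mat d → Mat d
(M +ₘ N) i j = M i j +ₛ N i j

0ₘ : ∀ {d} → Mat d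
0ₘ i j = 0ₛ

diag : ∀ {n} → PS → Mat n
diag c fzero fzero = c
diag c fzero (fsuc j) = 0ₛ
diag c (fsuc i) fzero = 0ₛ
diag c (fsuc i) (fsuc j) = diag c i j

diag-same : ∀ {n} c (i : Fin n) → diag c i i ≡ c
diag-same c fzero = refl
diag-same c (fsuc i) = diag-same c i

diag-other : ∀ {n} c (i j : Fin n) → i ≢ j → diag c i j ≡ 0ₛ
diag-other c fzero fzero i≢j = contradiction refl i≢j
diag-other c fzero (fsuc j) _ = refl
diag-other c (fsuc i) fzero _ = refl
diag-other c (fsuc i) (fsuc j) i≢j = diag-other c i j (i≢j ∘ cong fsuc)

uPowI≗diag : ∀ n h (i j : Fin n) → uPowI n h i j ≗ diag (monomial h) i j
uPowI≗diag n h i j m with i Fin.≟ j | m ℕ.≟ h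
... | yes refl | yes refl = sym (trans (cong (λ f → f m) (diag-same (monomial m) i)) (monomial-same m))
... | yes refl | no m≢h = sym (trans (cong (λ f → f m) (diag-same (monomial h) i)) (monomial-other h m m≢h))
... | no i≢j | _ = sym (cong (λ f → f m) (diag-other (monomial h) i j i≢j))

Iₘ-suc : ∀ d (i j : Fin d) n → Iₘ d i j (suc n) ≡ 0
Iₘ-suc d i j n with i Fin.≟ j | suc n ℕ.≟ 0
... | yes _ | no _ = refl
... | no _ | _ = refl

infix 4 _≡ₘ[<_]_
_≡ₘ[<_]_ : ∀ {d} → Mat d → ℕ → Mat d → Set
M ≡ₘ[< m ] N = ∀ i j → M i j ≡[< m ] N i j

sumFin-at : ∀ k (g g′ : Fin k → PS) n → (∀ l → g l n ≡ g′ l n) → sumFin k g n ≡ sumFin k g′ n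
sumFin-at zero g g′ n e = refl
sumFin-at (suc k) g g′ n e = cong₂ _+_ (e fzero) (sumFin-at k (g ∘ fsuc) (g′ ∘ fsuc) n (e ∘ fsuc))

sumFin-0ₛ : ∀ k → sumFin k (λ _ → 0ₛ) ≗ 0ₛ
sumFin-0ₛ zero n = refl
sumFin-0ₛ (suc k) n = sumFin-0ₛ k n

·ₘ-agree : ∀ {d m} {M M′ N N′ : Mat d} → M ≡ₘ[< m ] M′ → N ≡ₘ[< m ] N′ → (M ·ₘ N) ≡ₘ[< m ] (M′ ·ₘ N′)
·ₘ-agree {d} {M = M} {M′} {N} {N′} eM eN i j n n<m = sumFin-at d _ _ n λ l →
  ·ₛ-agree {M i l} {M′ i l} {N l j} {N′ l j} n (λ k k<1+n → eM i l k (≤-<-trans (s≤s⁻¹ k<1+n) n<m))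
                                             (λ k k<1+n → eN l j k (≤-<-trans (s≤s⁻¹ k<1+n) n<m))

·ₘ-agreeʳ : ∀ {d m} {N M M′ : Mat d} → (∀ i j → N i j 0 ≡ 0) → M ≡ₘ[< m ] M′ → (N ·ₘ M) ≡ₘ[< suc m ] (N ·ₘ M′)
·ₘ-agreeʳ {d} {N = N} {M} {M′} N₀ eM i j n n<1+m = sumFin-at d _ _ n λ l →
  ·ₛ-agreeʳ {N i l} {M l j} {M′ l j} n (N₀ i l) (λ k k<n → eM l j k (<-≤-trans k<n (s≤s⁻¹ n<1+m)))

·ₘ-agreeˡ : ∀ {d m} {N M M′ : Mat d} → (∀ i j → N i j 0 ≡ 0) → M ≡ₘ[< m ] M′ → (M ·ₘ N) ≡ₘ[< suc m ] (M′ ·ₘ N)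
·ₘ-agreeˡ {d} {N = N} {M} {M′} N₀ eM i j n n<1+m = sumFin-at d _ _ n λ l →
  ·ₛ-agreeˡ {M i l} {M′ i l} {N l j} n (N₀ l j) (λ k k<n → eM i l k (<-≤-trans k<n (s≤s⁻¹ n<1+m)))

·ₘ-vanishingʳ : ∀ {d m} (M N : Mat d) → N ≡ₘ[< m ] 0ₘ → (M ·ₘ N) ≡ₘ[< m ] 0ₘ
·ₘ-vanishingʳ {d} M N N≡0 i j n n<m = trans (sumFin-at d _ _ n λ l →
  trans (·ₛ-agree {M i l} {M i l} {N l j} {0ₛ} n (λ _ _ → refl) (λ k k<1+n → N≡0 l j k (≤-<-trans (s≤s⁻¹ k<1+n) n<m)))
        (·ₛ-zeroʳ (M i l) n)) (sumFin-0ₛ d n)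

·ₘ-vanishingˡ : ∀ {d m} (M N : Mat d) → M ≡ₘ[< m ] 0ₘ → (M ·ₘ N) ≡ₘ[< m ] 0ₘ
·ₘ-vanishingˡ {d} M N M≡0 i j n n<m = trans (sumFin-at d _ _ n λ l →
  ·ₛ-vanishingˡ (M i l) (N l j) n (λ k k<1+n → M≡0 i l k (≤-<-trans (s≤s⁻¹ k<1+n) n<m))) (sumFin-0ₛ d n)

module Contraction {d : ℕ} (G : Mat d → Mat d)
                   (contracts : ∀ {m M M′} → M ≡ₘ[< m ] M′ → G M ≡ₘ[< suc m ] G M′) where

  iterate : ℕ → Mat d
  iterate zero = 0ₘ
  iterate (suc k) = G (iterate k)

  iterate-step : ∀ m → iterate m ≡ₘ[< m ] iterate (suc m)
  iterate-step zero i j n ()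
  iterate-step (suc m) = contracts (iterate-step m)

  iterate-stable : ∀ m k → iterate m ≡ₘ[< m ] iterate (k + m)
  iterate-stable m zero i j n _ = refl
  iterate-stable m (suc k) i j n n<m =
    trans (iterate-stable m k i j n n<m) (iterate-step (k + m) i j n (<-≤-trans n<m (m≤n+m m k)))

  -- The u-adic limit of the iterates: coefficient n is stable from the (n + 1)-st iterate on.
  fixpoint : Mat d
  fixpoint i j n = iterate (suc n) i j n

  fixpoint-agree : ∀ m → fixpoint ≡ₘ[< m ] iterate m
  fixpoint-agree m i j n n<m =
    trans (iterate-stable (suc n) (m ∸ suc n) i j n ≤-refl) (cong (λ k → iterate k i j n) (m∸n+n≡m n<m))

  fixpoint-eq : ∀ i j → G fixpoint i j ≗ fixpoint i j
  fixpoint-eq i j n =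
    trans (contracts (fixpoint-agree (suc n)) i j n (s≤s (n≤1+n n))) (sym (iterate-step (suc n) i j n ≤-refl))

module MatrixModP (p d : ℕ) where

  open PowerSeriesModP p using (_≈_; ≗⇒≈; semiring)
  private module S = Semiring semiring
  open import Algebra.Properties.Semiring.Sum semiring
  open import Relation.Binary.Reasoning.Setoid S.setoid

  infix 4 _≈ₘ_
  _≈ₘ_ : Mat d → Mat d → Set
  _≈ₘ_ = MatEq p

  sumFin≡sum : ∀ n (g : Fin n → PS) → sumFin n g ≡ sum g
  sumFin≡sum zero g = refl
  sumFin≡sum (suc n) g = cong (g fzero +ₛ_) (sumFin≡sum n (λ l → g (fsuc l)))

  ·ₘ-entry : ∀ M N i j → (M ·ₘ N) i j ≡ ∑[ l < d ] (M i l ·ₛ N l j)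
  ·ₘ-entry M N i j = sumFin≡sum d (λ l → M i l ·ₛ N l j)

  ·ₘ-cong : ∀ {M M′ N N′} → M ≈ₘ M′ → N ≈ₘ N′ → (M ·ₘ N) ≈ₘ (M′ ·ₘ N′)
  ·ₘ-cong {M} {M′} {N} {N′} eM eN i j = begin
    (M ·ₘ N) i j                 ≡⟨ ·ₘ-entry M N i j ⟩
    ∑[ l < d ] (M i l ·ₛ N l j)   ≈⟨ sum-cong-≋ (λ l → S.*-cong (eM i l) (eN l j)) ⟩
    ∑[ l < d ] (M′ i l ·ₛ N′ l j) ≡⟨ ·ₘ-entry M′ N′ i j ⟨
    (M′ ·ₘ N′) i j               ∎

  ·ₘ-assoc : ∀ M N K → ((M ·ₘ N) ·ₘ K) ≈ₘ (M ·ₘ (N ·ₘ K))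
  ·ₘ-assoc M N K i j = begin
    ((M ·ₘ N) ·ₘ K) i j                                 ≡⟨ ·ₘ-entry (M ·ₘ N) K i j ⟩
    ∑[ m < d ] ((M ·ₘ N) i m ·ₛ K m j)                   ≡⟨ sum-cong-≗ (λ m → cong (_·ₛ K m j) (·ₘ-entry M N i m)) ⟩
    ∑[ m < d ] ((∑[ l < d ] (M i l ·ₛ N l m)) ·ₛ K m j)    ≈⟨ sum-cong-≋ (λ m → *-distribʳ-sum (K m j) (λ l → M i l ·ₛ N l m)) ⟩
    ∑[ m < d ] ∑[ l < d ] ((M i l ·ₛ N l m) ·ₛ K m j)    ≈⟨ ∑-comm (λ m l → (M i l ·ₛ N l m) ·ₛ K m j) ⟩
    ∑[ l < d ] ∑[ m < d ] ((M i l ·ₛ N l m) ·ₛ K m j)    ≈⟨ sum-cong-≋ (λ l → sum-cong-≋ (λ m → S.*-assoc (M i l) (N l m) (K m j))) ⟩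
    ∑[ l < d ] ∑[ m < d ] (M i l ·ₛ (N l m ·ₛ K m j))    ≈⟨ sum-cong-≋ (λ l → *-distribˡ-sum (M i l) (λ m → N l m ·ₛ K m j)) ⟨
    ∑[ l < d ] (M i l ·ₛ (∑[ m < d ] (N l m ·ₛ K m j)))    ≡⟨ sum-cong-≗ (λ l → cong (M i l ·ₛ_) (·ₘ-entry N K l j)) ⟨
    ∑[ l < d ] (M i l ·ₛ (N ·ₘ K) l j)                   ≡⟨ ·ₘ-entry M (N ·ₘ K) i j ⟨
    (M ·ₘ (N ·ₘ K)) i j                                 ∎

  ·ₘ-distribˡ : ∀ M N K → (M ·ₘ (N +ₘ K)) ≈ₘ ((M ·ₘ N) +ₘ (M ·ₘ K))
  ·ₘ-distribˡ M N K i j = begin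
    (M ·ₘ (N +ₘ K)) i j                                         ≡⟨ ·ₘ-entry M (N +ₘ K) i j ⟩
    ∑[ l < d ] (M i l ·ₛ (N l j +ₛ K l j))                       ≈⟨ sum-cong-≋ (λ l → S.distribˡ (M i l) (N l j) (K l j)) ⟩
    ∑[ l < d ] ((M i l ·ₛ N l j) +ₛ (M i l ·ₛ K l j))            ≈⟨ ∑-distrib-+ (λ l → M i l ·ₛ N l j) (λ l → M i l ·ₛ K l j) ⟩
    (∑[ l < d ] (M i l ·ₛ N l j)) +ₛ (∑[ l < d ] (M i l ·ₛ K l j)) ≡⟨ cong₂ _+ₛ_ (·ₘ-entry M N i j) (·ₘ-entry M K i j) ⟨
    ((M ·ₘ N) +ₘ (M ·ₘ K)) i j                                  ∎

  ·ₘ-distribʳ : ∀ K M N → ((M +ₘ N) ·ₘ K) ≈ₘ ((M ·ₘ K) +ₘ (N ·ₘ K))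
  ·ₘ-distribʳ K M N i j = begin
    ((M +ₘ N) ·ₘ K) i j                                         ≡⟨ ·ₘ-entry (M +ₘ N) K i j ⟩
    ∑[ l < d ] ((M i l +ₛ N i l) ·ₛ K l j)                       ≈⟨ sum-cong-≋ (λ l → S.distribʳ (K l j) (M i l) (N i l)) ⟩
    ∑[ l < d ] ((M i l ·ₛ K l j) +ₛ (N i l ·ₛ K l j))            ≈⟨ ∑-distrib-+ (λ l → M i l ·ₛ K l j) (λ l → N i l ·ₛ K l j) ⟩
    (∑[ l < d ] (M i l ·ₛ K l j)) +ₛ (∑[ l < d ] (N i l ·ₛ K l j)) ≡⟨ cong₂ _+ₛ_ (·ₘ-entry M K i j) (·ₘ-entry N K i j) ⟨
    ((M ·ₘ K) +ₘ (N ·ₘ K)) i j                                  ∎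

  ·ₘ-zeroˡ : ∀ M → (0ₘ ·ₘ M) ≈ₘ 0ₘ
  ·ₘ-zeroˡ M i j = begin
    (0ₘ ·ₘ M) i j               ≡⟨ ·ₘ-entry 0ₘ M i j ⟩
    ∑[ l < d ] (0ₛ ·ₛ M l j)    ≈⟨ sum-cong-≋ (λ l → S.zeroˡ (M l j)) ⟩
    ∑[ l < d ] 0ₛ               ≈⟨ sum-replicate-zero d ⟩
    0ₛ                          ∎

  ·ₘ-zeroʳ : ∀ M → (M ·ₘ 0ₘ) ≈ₘ 0ₘ
  ·ₘ-zeroʳ M i j = begin
    (M ·ₘ 0ₘ) i j               ≡⟨ ·ₘ-entry M 0ₘ i j ⟩
    ∑[ l < d ] (M i l ·ₛ 0ₛ)    ≈⟨ sum-cong-≋ (λ l → S.zeroʳ (M i l)) ⟩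
    ∑[ l < d ] 0ₛ               ≈⟨ sum-replicate-zero d ⟩
    0ₛ                          ∎

  ∑-diagˡ : ∀ {n} c (i : Fin n) (v : Fin n → PS) → (∑[ l < n ] (diag c i l ·ₛ v l)) ≈ (c ·ₛ v i)
  ∑-diagˡ {suc n} c fzero v = begin
    (c ·ₛ v fzero) +ₛ (∑[ l < n ] (0ₛ ·ₛ v (fsuc l))) ≈⟨ S.+-congˡ (sum-cong-≋ (λ l → S.zeroˡ (v (fsuc l)))) ⟩
    (c ·ₛ v fzero) +ₛ (∑[ l < n ] 0ₛ)                  ≈⟨ S.+-congˡ (sum-replicate-zero n) ⟩
    (c ·ₛ v fzero) +ₛ 0ₛ                               ≈⟨ S.+-identityʳ _ ⟩
    c ·ₛ v fzero                                       ∎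
  ∑-diagˡ {suc n} c (fsuc i) v = begin
    (0ₛ ·ₛ v fzero) +ₛ (∑[ l < n ] (diag c i l ·ₛ v (fsuc l))) ≈⟨ S.+-cong (S.zeroˡ (v fzero)) (∑-diagˡ c i (λ l → v (fsuc l))) ⟩
    0ₛ +ₛ (c ·ₛ v (fsuc i))                                    ≈⟨ S.+-identityˡ _ ⟩
    c ·ₛ v (fsuc i)                                            ∎

  ∑-diagʳ : ∀ {n} c (j : Fin n) (v : Fin n → PS) → (∑[ l < n ] (v l ·ₛ diag c l j)) ≈ (v j ·ₛ c)
  ∑-diagʳ {suc n} c fzero v = begin
    (v fzero ·ₛ c) +ₛ (∑[ l < n ] (v (fsuc l) ·ₛ 0ₛ)) ≈⟨ S.+-congˡ (sum-cong-≋ (λ l → S.zeroʳ (v (fsuc l)))) ⟩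
    (v fzero ·ₛ c) +ₛ (∑[ l < n ] 0ₛ)                  ≈⟨ S.+-congˡ (sum-replicate-zero n) ⟩
    (v fzero ·ₛ c) +ₛ 0ₛ                               ≈⟨ S.+-identityʳ _ ⟩
    v fzero ·ₛ c                                       ∎
  ∑-diagʳ {suc n} c (fsuc j) v = begin
    (v fzero ·ₛ 0ₛ) +ₛ (∑[ l < n ] (v (fsuc l) ·ₛ diag c l j)) ≈⟨ S.+-cong (S.zeroʳ (v fzero)) (∑-diagʳ c j (λ l → v (fsuc l))) ⟩
    0ₛ +ₛ (v (fsuc j) ·ₛ c)                                    ≈⟨ S.+-identityˡ _ ⟩
    v (fsuc j) ·ₛ c                                            ∎

  uPowI-·ₘ : ∀ h M i j → (uPowI d h ·ₘ M) i j ≈ shiftR h (M i j)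
  uPowI-·ₘ h M i j = begin
    (uPowI d h ·ₘ M) i j                            ≡⟨ ·ₘ-entry (uPowI d h) M i j ⟩
    ∑[ l < d ] (uPowI d h i l ·ₛ M l j)              ≈⟨ sum-cong-≋ (λ l → S.*-congʳ {M l j} (≗⇒≈ (uPowI≗diag d h i l))) ⟩
    ∑[ l < d ] (diag (monomial h) i l ·ₛ M l j)      ≈⟨ ∑-diagˡ (monomial h) i (λ l → M l j) ⟩
    monomial h ·ₛ M i j                             ≈⟨ ≗⇒≈ (·ₛ-monomialˡ h (M i j)) ⟩
    shiftR h (M i j)                                ∎

  ·ₘ-uPowI : ∀ h M i j → (M ·ₘ uPowI d h) i j ≈ shiftR h (M i j)
  ·ₘ-uPowI h M i j = begin
    (M ·ₘ uPowI d h) i j                            ≡⟨ ·ₘ-entry M (uPowI d h) i j ⟩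
    ∑[ l < d ] (M i l ·ₛ uPowI d h l j)              ≈⟨ sum-cong-≋ (λ l → S.*-congˡ {M i l} (≗⇒≈ (uPowI≗diag d h l j))) ⟩
    ∑[ l < d ] (M i l ·ₛ diag (monomial h) l j)      ≈⟨ ∑-diagʳ (monomial h) j (λ l → M i l) ⟩
    M i j ·ₛ monomial h                             ≈⟨ ≗⇒≈ (·ₛ-monomialʳ h (M i j)) ⟩
    shiftR h (M i j)                                ∎

  uPowI-central : ∀ h M → (M ·ₘ uPowI d h) ≈ₘ (uPowI d h ·ₘ M)
  uPowI-central h M i j = S.trans (·ₘ-uPowI h M i j) (S.sym (uPowI-·ₘ h M i j))

  uPowI-cancelˡ : ∀ h {M N} → (uPowI d h ·ₘ M) ≈ₘ (uPowI d h ·ₘ N) → M ≈ₘ N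
  uPowI-cancelˡ h {M} {N} e i j n =
    subst₂ (_≡[mod p ]_) (shiftR-k+n h (M i j) n) (shiftR-k+n h (N i j) n)
      (≡[mod]-trans (≡[mod]-sym (uPowI-·ₘ h M i j (h + n)))
        (≡[mod]-trans (e i j (h + n)) (uPowI-·ₘ h N i j (h + n))))

  isSemiringₘ : IsSemiring _≈ₘ_ _+ₘ_ _·ₘ_ 0ₘ (Iₘ d)
  isSemiringₘ = record
    { isSemiringWithoutAnnihilatingZero = record
      { +-isCommutativeMonoid = record
        { isMonoid = record
          { isSemigroup = record
            { isMagma = record
              { isEquivalence = record
                { refl = λ i j → S.refl ; sym = λ e i j → S.sym (e i j) ; trans = λ e e′ i j → S.trans (e i j) (e′ i j) }
              ; ∙-cong = λ e e′ i j → S.+-cong (e i j) (e′ i j) }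
            ; assoc = λ M N K i j → S.+-assoc (M i j) (N i j) (K i j) }
          ; identity = (λ M i j → S.+-identityˡ (M i j)) , (λ M i j → S.+-identityʳ (M i j)) }
        ; comm = λ M N i j → S.+-comm (M i j) (N i j) }
      ; *-cong = ·ₘ-cong
      ; *-assoc = ·ₘ-assoc
      ; *-identity = uPowI-·ₘ 0 , ·ₘ-uPowI 0
      ; distrib = ·ₘ-distribˡ , ·ₘ-distribʳ
      }
    ; zero = ·ₘ-zeroˡ , ·ₘ-zeroʳ
    }

  semiringₘ : Semiring 0ℓ 0ℓ
  semiringₘ = record { isSemiring = isSemiringₘ }

module FrobeniusOnMatrices (p′ d : ℕ) where

  open Frobenius p′
  open MatrixModP p d
  open PowerSeriesModP p using (≗⇒≈)
  module 𝕄 = Semiring semiringₘ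

  φ-sumFin : ∀ k (g : Fin k → PS) → φ (sumFin k g) ≗ sumFin k (φ ∘ g)
  φ-sumFin zero g = φ-0ₛ
  φ-sumFin (suc k) g n = trans (φ-+ (g fzero) _ n) (cong (φ (g fzero) n +_) (φ-sumFin k (g ∘ fsuc) n))

  φ-diag : ∀ {k} c → φ c ≗ c → (i j : Fin k) → φ (diag c i j) ≗ diag c i j
  φ-diag c φc≗c fzero fzero = φc≗c
  φ-diag c φc≗c fzero (fsuc j) = φ-0ₛ
  φ-diag c φc≗c (fsuc i) fzero = φ-0ₛ
  φ-diag c φc≗c (fsuc i) (fsuc j) = φ-diag c φc≗c i j

  φₘ-·ₘ : ∀ M N → φₘ p (M ·ₘ N) ≈ₘ (φₘ p M ·ₘ φₘ p N)
  φₘ-·ₘ M N i j = ≗⇒≈ λ n →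
    trans (φ-sumFin d (λ l → M i l ·ₛ N l j) n) (sumFin-at d _ _ n (λ l → sym (φ-·ₛ (M i l) (N l j) n)))

  φₘ-+ₘ : ∀ M N → φₘ p (M +ₘ N) ≈ₘ (φₘ p M +ₘ φₘ p N)
  φₘ-+ₘ M N i j = ≗⇒≈ (φ-+ (M i j) (N i j))

  φₘ-Iₘ : φₘ p (Iₘ d) ≈ₘ Iₘ d
  φₘ-Iₘ i j = ≗⇒≈ λ n → begin
    φ (uPowI d 0 i j) n           ≡⟨ φ-cong (uPowI≗diag d 0 i j) n ⟩
    φ (diag (monomial 0) i j) n   ≡⟨ φ-diag (monomial 0) φ-monomial₀ i j n ⟩
    diag (monomial 0) i j n       ≡⟨ uPowI≗diag d 0 i j n ⟨
    uPowI d 0 i j n               ∎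
    where open ≡-Reasoning

  φₘ-cong : ∀ {M N} → M ≈ₘ N → φₘ p M ≈ₘ φₘ p N
  φₘ-cong M≈N i j n with p ∣? n
  ... | yes (divides q _) = M≈N i j q
  ... | no _ = ≡⇒≡[mod] refl

  φₘ-agree : ∀ {m} {M M′ : Mat d} → M ≡ₘ[< m ] M′ → φₘ p M ≡ₘ[< p * m ] φₘ p M′
  φₘ-agree {m} e i j = φ-agree m (e i j)

  twisted-conjugate : ∀ {Y R A C} → (Y ·ₘ A) ≈ₘ (C ·ₘ φₘ p Y) → (Y ·ₘ R) ≈ₘ Iₘ d → ((Y ·ₘ A) ·ₘ φₘ p R) ≈ₘ C
  twisted-conjugate {Y} {R} {A} {C} YA≈CφY YR≈I = begin
    (Y ·ₘ A) ·ₘ φₘ p R          ≈⟨ 𝕄.*-congʳ {φₘ p R} YA≈CφY ⟩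
    (C ·ₘ φₘ p Y) ·ₘ φₘ p R     ≈⟨ 𝕄.*-assoc C (φₘ p Y) (φₘ p R) ⟩
    C ·ₘ (φₘ p Y ·ₘ φₘ p R)     ≈⟨ 𝕄.*-congˡ {C} (φₘ-·ₘ Y R) ⟨
    C ·ₘ φₘ p (Y ·ₘ R)          ≈⟨ 𝕄.*-congˡ {C} (𝕄.trans (φₘ-cong YR≈I) φₘ-Iₘ) ⟩
    C ·ₘ Iₘ d                   ≈⟨ 𝕄.*-identityʳ C ⟩
    C                           ∎
    where open import Relation.Binary.Reasoning.Setoid 𝕄.setoid

module UnipotentInverse (p′ d : ℕ) where

  open MatrixModP (suc p′) d
  open PowerSeriesModP (suc p′) using (≗⇒≈)
  module 𝕄 = Semiring semiringₘ
  open import Relation.Binary.Reasoning.Setoid 𝕄.setoid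

  unipotent-invertible : ∀ E → (∀ i j → E i j 0 ≡ 0) →
    ∃ λ R → ((Iₘ d +ₘ E) ·ₘ R) ≈ₘ Iₘ d × (R ·ₘ (Iₘ d +ₘ E)) ≈ₘ Iₘ d
  unipotent-invertible E E₀ = R , YR≈I , RY≈I
    where
    Y : Mat d
    Y = Iₘ d +ₘ E

    -- N plays the role of −E, as p′ E + E = p E ≡ 0.
    N : Mat d
    N i j n = p′ * E i j n

    N+E≈0 : (N +ₘ E) ≈ₘ 0ₘ
    N+E≈0 i j n = ≡[mod]-multiple p′ (E i j n)

    N₀ : ∀ i j → N i j 0 ≡ 0
    N₀ i j = trans (cong (p′ *_) (E₀ i j)) (*-zeroʳ p′)

    module Right = Contraction (λ M → Iₘ d +ₘ (N ·ₘ M))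
      (λ e i j n n<m → cong (Iₘ d i j n +_) (·ₘ-agreeʳ {N = N} N₀ e i j n n<m))
    module Left = Contraction (λ M → Iₘ d +ₘ (M ·ₘ N))
      (λ e i j n n<m → cong (Iₘ d i j n +_) (·ₘ-agreeˡ {N = N} N₀ e i j n n<m))

    R L : Mat d
    R = Right.fixpoint
    L = Left.fixpoint

    YR≈I : (Y ·ₘ R) ≈ₘ Iₘ d
    YR≈I = begin
      Y ·ₘ R                             ≈⟨ 𝕄.distribʳ R (Iₘ d) E ⟩
      Iₘ d ·ₘ R +ₘ E ·ₘ R                ≈⟨ 𝕄.+-congʳ (𝕄.*-identityˡ R) ⟩
      R +ₘ E ·ₘ R                        ≈⟨ 𝕄.+-congʳ (λ i j → ≗⇒≈ (sym ∘ Right.fixpoint-eq i j)) ⟩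
      Iₘ d +ₘ N ·ₘ R +ₘ E ·ₘ R           ≈⟨ 𝕄.+-assoc (Iₘ d) _ _ ⟩
      Iₘ d +ₘ (N ·ₘ R +ₘ E ·ₘ R)         ≈⟨ 𝕄.+-congˡ (𝕄.distribʳ R N E) ⟨
      Iₘ d +ₘ (N +ₘ E) ·ₘ R              ≈⟨ 𝕄.+-congˡ (𝕄.*-congʳ {R} N+E≈0) ⟩
      Iₘ d +ₘ 0ₘ ·ₘ R                    ≈⟨ 𝕄.+-congˡ (𝕄.zeroˡ R) ⟩
      Iₘ d +ₘ 0ₘ                         ≈⟨ 𝕄.+-identityʳ (Iₘ d) ⟩
      Iₘ d                               ∎

    LY≈I : (L ·ₘ Y) ≈ₘ Iₘ d
    LY≈I = begin
      L ·ₘ Y                             ≈⟨ 𝕄.distribˡ L (Iₘ d) E ⟩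
      L ·ₘ Iₘ d +ₘ L ·ₘ E                ≈⟨ 𝕄.+-congʳ (𝕄.*-identityʳ L) ⟩
      L +ₘ L ·ₘ E                        ≈⟨ 𝕄.+-congʳ (λ i j → ≗⇒≈ (sym ∘ Left.fixpoint-eq i j)) ⟩
      Iₘ d +ₘ L ·ₘ N +ₘ L ·ₘ E           ≈⟨ 𝕄.+-assoc (Iₘ d) _ _ ⟩
      Iₘ d +ₘ (L ·ₘ N +ₘ L ·ₘ E)         ≈⟨ 𝕄.+-congˡ (𝕄.distribˡ L N E) ⟨
      Iₘ d +ₘ L ·ₘ (N +ₘ E)              ≈⟨ 𝕄.+-congˡ (𝕄.*-congˡ {L} N+E≈0) ⟩
      Iₘ d +ₘ L ·ₘ 0ₘ                    ≈⟨ 𝕄.+-congˡ (𝕄.zeroʳ L) ⟩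
      Iₘ d +ₘ 0ₘ                         ≈⟨ 𝕄.+-identityʳ (Iₘ d) ⟩
      Iₘ d                               ∎

    R≈L : R ≈ₘ L
    R≈L = begin
      R                  ≈⟨ 𝕄.*-identityˡ R ⟨
      Iₘ d ·ₘ R          ≈⟨ 𝕄.*-congʳ {R} LY≈I ⟨
      (L ·ₘ Y) ·ₘ R      ≈⟨ 𝕄.*-assoc L Y R ⟩
      L ·ₘ (Y ·ₘ R)      ≈⟨ 𝕄.*-congˡ {L} YR≈I ⟩
      L ·ₘ Iₘ d          ≈⟨ 𝕄.*-identityʳ L ⟩
      L                  ∎

    RY≈I : (R ·ₘ Y) ≈ₘ Iₘ d
    RY≈I = 𝕄.trans (𝕄.*-congʳ {Y} R≈L) LY≈I

frobenius-room : ∀ p′ {h k m} → h + 3 ≤ 2 * suc p′ → 2 + k ≤ m → h + (2 + k) < suc p′ * m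
frobenius-room p′ {h} {k} {m} bound 2+k≤m = begin-strict
  h + (2 + k)          <⟨ ≤-reflexive (lemma h k) ⟩
  (h + 3) + k          ≤⟨ +-mono-≤ bound (m≤n*m k (suc p′)) ⟩
  2 * p + p * k        ≡⟨ cong (_+ p * k) (*-comm 2 p) ⟩
  p * 2 + p * k        ≡⟨ *-distribˡ-+ p 2 k ⟨
  p * (2 + k)          ≤⟨ *-monoʳ-≤ p 2+k≤m ⟩
  p * m                ∎
  where
  open ≤-Reasoning
  p = suc p′
  lemma : ∀ h k → suc (h + (2 + k)) ≡ (h + 3) + k
  lemma = solve-∀

module TwistedEquation (p′ d h : ℕ) (A B X : Mat d)
                       (bound : h + 3 ≤ 2 * suc p′)
                       (BA≈U : MatEq (suc p′) (B ·ₘ A) (uPowI d h))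
                       (X≡I : MatEqModU (suc p′) 2 X (Iₘ d)) where

  open Frobenius p′ using (p; φ-0ₛ)
  open MatrixModP p d
  open PowerSeriesModP p using (≗⇒≈)
  open FrobeniusOnMatrices p′ d using (φₘ-agree; φₘ-+ₘ; φₘ-Iₘ)
  module 𝕄 = Semiring semiringₘ
  module S = Semiring (PowerSeriesModP.semiring p)

  U XA T : Mat d
  U = uPowI d h
  XA = X ·ₘ A
  -- T stands for X − I: dropping the coefficients of u⁰ and u¹ avoids subtraction in ℕ,
  -- and X ≡ I mod u² gives X ≈ I + T.
  T i j = dropBelow 2 (X i j)

  correction : Mat d → Mat d
  correction M = (XA ·ₘ φₘ p M) ·ₘ B

  step : Mat d → Mat d
  step M i j = dropBelow 2 (X i j +ₛ shiftL h (correction M i j))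

  step-contracts : ∀ {m M M′} → M ≡ₘ[< m ] M′ → step M ≡ₘ[< suc m ] step M′
  step-contracts e i j zero _ = refl
  step-contracts e i j (suc zero) _ = refl
  step-contracts e i j (suc (suc k)) 2+k<1+m = cong (X i j (2 + k) +_)
    (·ₘ-agree {N = B} {B} (·ₘ-agree {M = XA} {XA} (λ _ _ _ _ → refl) (φₘ-agree e)) (λ _ _ _ _ → refl)
      i j (h + (2 + k)) (frobenius-room p′ bound (s≤s⁻¹ 2+k<1+m)))

  open Contraction step step-contracts using (fixpoint; fixpoint-eq)

  E Y W : Mat d
  E = fixpoint
  Y = Iₘ d +ₘ E
  W = XA ·ₘ φₘ p E

  E-vanishes : E ≡ₘ[< 2 ] 0ₘ
  E-vanishes i j zero _ = sym (fixpoint-eq i j 0)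
  E-vanishes i j (suc zero) _ = sym (fixpoint-eq i j 1)
  E-vanishes i j (suc (suc n)) (s≤s (s≤s ()))

  WB-vanishes : (W ·ₘ B) ≡ₘ[< h + 2 ] 0ₘ
  WB-vanishes i j n n<h+2 = ·ₘ-vanishingˡ W B
    (·ₘ-vanishingʳ XA (φₘ p E) (λ i j n n<2p → trans (φₘ-agree E-vanishes i j n n<2p) (φ-0ₛ n)))
    i j n (<-trans n<h+2 (frobenius-room p′ {k = 0} bound ≤-refl))

  E-decomposition : ∀ i j → E i j ≗ (T i j +ₛ shiftL h ((W ·ₘ B) i j))
  E-decomposition i j n = begin
    E i j n                                                      ≡⟨ fixpoint-eq i j n ⟨
    dropBelow 2 (X i j +ₛ shiftL h ((W ·ₘ B) i j)) n             ≡⟨ dropBelow-+ 2 (X i j) (shiftL h ((W ·ₘ B) i j)) n ⟩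
    T i j n + dropBelow 2 (shiftL h ((W ·ₘ B) i j)) n            ≡⟨ cong (T i j n +_) (shiftR-shiftL 2 _
                                                                      (λ k k<2 → WB-vanishes i j (h + k) (+-monoʳ-< h k<2)) n) ⟩
    T i j n + shiftL h ((W ·ₘ B) i j) n                          ∎
    where open ≡-Reasoning

  UE≈UT+WB : (U ·ₘ E) ≈ₘ (U ·ₘ T +ₘ W ·ₘ B)
  UE≈UT+WB i j = begin
    (U ·ₘ E) i j                                             ≈⟨ uPowI-·ₘ h E i j ⟩
    shiftR h (E i j)                                         ≈⟨ ≗⇒≈ (shiftR-cong h (E-decomposition i j)) ⟩
    shiftR h (T i j +ₛ shiftL h ((W ·ₘ B) i j))              ≈⟨ ≗⇒≈ (shiftR-+ h (T i j) _) ⟩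
    shiftR h (T i j) +ₛ shiftR h (shiftL h ((W ·ₘ B) i j))   ≈⟨ S.+-cong (S.sym (uPowI-·ₘ h T i j))
                                                                   (≗⇒≈ (shiftR-shiftL h _ λ k k<h → WB-vanishes i j k (≤-trans k<h (m≤m+n h 2)))) ⟩
    (U ·ₘ T) i j +ₛ (W ·ₘ B) i j                             ∎
    where open import Relation.Binary.Reasoning.Setoid S.setoid

  X≈I+T : X ≈ₘ (Iₘ d +ₘ T)
  X≈I+T i j zero = ≡[mod]-trans (X≡I i j 0 (s≤s z≤n)) (≡⇒≡[mod] (sym (+-identityʳ _)))
  X≈I+T i j (suc zero) = ≡[mod]-trans (X≡I i j 1 (s≤s (s≤s z≤n))) (≡⇒≡[mod] (sym (+-identityʳ _)))
  X≈I+T i j (suc (suc n)) = ≡⇒≡[mod] (cong (_+ X i j (2 + n)) (sym (Iₘ-suc d i j (suc n))))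

  open import Relation.Binary.Reasoning.Setoid 𝕄.setoid

  XAφY≈A+TA+W : (XA ·ₘ φₘ p Y) ≈ₘ (A +ₘ (T ·ₘ A +ₘ W))
  XAφY≈A+TA+W = begin
    XA ·ₘ φₘ p Y                 ≈⟨ 𝕄.*-congˡ {XA} (𝕄.trans (φₘ-+ₘ (Iₘ d) E) (𝕄.+-congʳ φₘ-Iₘ)) ⟩
    XA ·ₘ (Iₘ d +ₘ φₘ p E)       ≈⟨ 𝕄.distribˡ XA (Iₘ d) (φₘ p E) ⟩
    XA ·ₘ Iₘ d +ₘ W              ≈⟨ 𝕄.+-congʳ (𝕄.*-identityʳ XA) ⟩
    XA +ₘ W                      ≈⟨ 𝕄.+-congʳ (𝕄.*-congʳ {A} X≈I+T) ⟩
    (Iₘ d +ₘ T) ·ₘ A +ₘ W        ≈⟨ 𝕄.+-congʳ (𝕄.distribʳ A (Iₘ d) T) ⟩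
    Iₘ d ·ₘ A +ₘ T ·ₘ A +ₘ W     ≈⟨ 𝕄.+-congʳ (𝕄.+-congʳ (𝕄.*-identityˡ A)) ⟩
    A +ₘ T ·ₘ A +ₘ W             ≈⟨ 𝕄.+-assoc A (T ·ₘ A) W ⟩
    A +ₘ (T ·ₘ A +ₘ W)           ∎

  W·BA≈U·W : (W ·ₘ (B ·ₘ A)) ≈ₘ (U ·ₘ W)
  W·BA≈U·W = 𝕄.trans (𝕄.*-congˡ {W} BA≈U) (uPowI-central h W)

  U·YA≈U·XAφY : (U ·ₘ (Y ·ₘ A)) ≈ₘ (U ·ₘ (XA ·ₘ φₘ p Y))
  U·YA≈U·XAφY = begin
    U ·ₘ (Y ·ₘ A)                                    ≈⟨ 𝕄.*-assoc U Y A ⟨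
    (U ·ₘ Y) ·ₘ A                                    ≈⟨ 𝕄.*-congʳ {A} (𝕄.distribˡ U (Iₘ d) E) ⟩
    (U ·ₘ Iₘ d +ₘ U ·ₘ E) ·ₘ A                       ≈⟨ 𝕄.*-congʳ {A} (𝕄.+-cong (𝕄.*-identityʳ U) UE≈UT+WB) ⟩
    (U +ₘ (U ·ₘ T +ₘ W ·ₘ B)) ·ₘ A                   ≈⟨ 𝕄.distribʳ A U _ ⟩
    U ·ₘ A +ₘ (U ·ₘ T +ₘ W ·ₘ B) ·ₘ A                ≈⟨ 𝕄.+-congˡ (𝕄.distribʳ A (U ·ₘ T) (W ·ₘ B)) ⟩
    U ·ₘ A +ₘ ((U ·ₘ T) ·ₘ A +ₘ (W ·ₘ B) ·ₘ A)       ≈⟨ 𝕄.+-congˡ {U ·ₘ A} (𝕄.+-cong (𝕄.*-assoc U T A) (𝕄.*-assoc W B A)) ⟩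
    U ·ₘ A +ₘ (U ·ₘ (T ·ₘ A) +ₘ W ·ₘ (B ·ₘ A))       ≈⟨ 𝕄.+-congˡ {U ·ₘ A} (𝕄.+-congˡ {U ·ₘ (T ·ₘ A)} W·BA≈U·W) ⟩
    U ·ₘ A +ₘ (U ·ₘ (T ·ₘ A) +ₘ U ·ₘ W)              ≈⟨ 𝕄.+-congˡ (𝕄.distribˡ U (T ·ₘ A) W) ⟨
    U ·ₘ A +ₘ U ·ₘ (T ·ₘ A +ₘ W)                     ≈⟨ 𝕄.distribˡ U A _ ⟨
    U ·ₘ (A +ₘ (T ·ₘ A +ₘ W))                        ≈⟨ 𝕄.*-congˡ {U} XAφY≈A+TA+W ⟨
    U ·ₘ (XA ·ₘ φₘ p Y)                              ∎

  YA≈XAφY : (Y ·ₘ A) ≈ₘ (XA ·ₘ φₘ p Y)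
  YA≈XAφY = uPowI-cancelˡ h U·YA≈U·XAφY

  E₀ : ∀ i j → E i j 0 ≡ 0
  E₀ i j = E-vanishes i j 0 (s≤s z≤n)

lemma5p2 : (p : ℕ) → Prime p → (d : ℕ) → 1 ≤ d → (h : ℕ) → h + 3 ≤ 2 * p →
    (A : Mat d) → InMh p d h A →
    (X : Mat d) → MatEqModU p 2 X (Iₘ d) →
    ∃₂ λ (Y Yinv : Mat d) →
    MatEq p (Y ·ₘ Yinv) (Iₘ d) × MatEq p (Yinv ·ₘ Y) (Iₘ d) ×
    MatEq p ((Y ·ₘ A) ·ₘ φₘ p Yinv) (X ·ₘ A)
lemma5p2 zero _ _ _ h bound = contradiction (m+n≤o⇒n≤o h bound) λ ()
lemma5p2 (suc p′) _ d _ h bound A (B , _ , BA≈U) X X≡I =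
  let R , YR≈I , RY≈I = unipotent-invertible E E₀
  in Y , R , YR≈I , RY≈I , twisted-conjugate YA≈XAφY YR≈I
  where
  open TwistedEquation p′ d h A B X bound BA≈U X≡I using (Y; E; E₀; YA≈XAφY)
  open UnipotentInverse p′ d using (unipotent-invertible)
  open FrobeniusOnMatrices p′ d using (twisted-conjugate)
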